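{- For every positive integer $m$, $$\zeta(m+1)=\frac{2^m}{2^m-1}\sum_{n=1}^\infty\frac{S_n(m)}{n2^n},$$ where $\zeta$ is the Riemann zeta function and $S_n(m)=\sum_{k=1}^n\binom{n}{k}\frac{(-1)^{k-1}}{k^m}$. -}

module Defs where

open import Data.Nat.Properties as ℕP using (m^n≢0; m*n≢0)
open import Data.Nat as ℕ using (ℕ; zero; suc; _^_; _≥_)
open import Data.Nat.Combinatorics using (_C_)
open import Data.Integer as ℤ using (ℤ; +_)
open import Data.Rational as ℚ using (ℚ; _/_; _+_; _-_; _*_; _<_; ∣_∣; 0ℚ)
open import Data.Product using (∃; _×_)

sumFrom1 : ℕ → (ℕ → ℚ) → ℚ
sumFrom1 zero    f = 0ℚ
sumFrom1 (suc n) f = sumFrom1 n f + f (suc n)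

sign : ℕ → ℚ
sign zero = ℚ.1ℚ
sign (suc j) = ℚ.- sign j

-- 1 / k^m  for k ≥ 1 (argument k = suc j)
invPow : (j m : ℕ) → ℚ
invPow j m = (+ 1) / (suc j ^ m)
  where instance _ = m^n≢0 (suc j) m

S : ℕ → ℕ → ℚ
S n m = sumFrom1 n (λ k → term k)
  where
  term : ℕ → ℚ
  term zero    = 0ℚ
  term (suc j) = ((+ (n C suc j)) / 1) * sign j * invPow j m

zetaPartial : ℕ → ℕ → ℚ
zetaPartial s N = sumFrom1 N (λ { zero → 0ℚ ; (suc j) → invPow j s })

rhsPartial : ℕ → ℕ → ℚ
rhsPartial m N = sumFrom1 N (λ { zero → 0ℚ ; (suc j) → S (suc j) m * invNTwo j })
  where
  invNTwo : ℕ → ℚ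
  invNTwo j = (+ 1) / (suc j ℕ.* 2 ^ suc j)
    where instance _ = m*n≢0 (suc j) (2 ^ suc j) {{_}} {{m^n≢0 2 (suc j)}}

twoPow : ℕ → ℚ
twoPow m = (+ (2 ^ m)) / 1

twoPowMinus1 : ℕ → ℚ
twoPowMinus1 m = (+ (2 ^ m ℕ.∸ 1)) / 1

{-# OPTIONS --safe #-}
-- Let s = m + 1, and let ζ_N and η_N be the partial sums of Σ k^-s and Σ (-1)^(k-1) k^-s.
-- Absorption C(n,k)/n = C(n-1,k-1)/k and Pascal's rule show by induction on N that the N-th
-- partial sum of the series is η_N - E_N, where E_N = 2^-N Σ_{k≤N} (-1)^(k-1) k^-s Σ_{i<k} C(N,i)
-- (this is Σ_{n=k}^{N} C(n-1,k-1) 2^-n = 1 - 2^-N Σ_{i<k} C(N,i) in disguise). Splitting off the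
-- even terms of η_N gives 2^m η_N = 2^m ζ_N - ζ_⌊N/2⌋, so the quantity to be estimated is
-- (ζ_⌊N/2⌋ - ζ_N) + 2^m E_N. Both summands are at most 4/(N+1) in absolute value, because
-- k^-s ≤ 2/k - 2/(k+1) for s ≥ 2: for the first this telescopes directly, for the second after
-- summation by parts, using Σ_{k≤N} C(N,k-1)/k = Σ_{k≤N} C(N+1,k)/(N+1) ≤ 2^(N+1)/(N+1).
module Submission where

open import Data.Empty using (⊥-elim)
open import Data.Integer as ℤ using (+_)
import Data.Integer.Properties as ℤP
open import Data.Nat as ℕ using (ℕ; zero; suc; NonZero; _^_; _≥_)
import Data.Nat.Properties as ℕP
open import Data.Nat.Combinatorics using (_C_; nC1≡n; nCk+nC[k+1]≡[n+1]C[k+1]; k>n⇒nCk≡0)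
import Data.Nat.Tactic.RingSolver as ℕ-Ring
open import Data.Product using (∃; _,_)
open import Data.Rational as ℚ using (ℚ; _+_; _*_; _-_; -_; 0ℚ; 1ℚ; _/_; _≤_; _<_; toℚᵘ; ∣_∣)
import Data.Rational.Properties as ℚP
open import Data.Rational.Unnormalised as ℚᵘ using (mkℚᵘ; *≡*; *≤*; *<*) renaming (_≃_ to _≃ᵘ_)
import Data.Rational.Unnormalised.Properties as ℚᵘP
open import Data.Sum using (_⊎_; inj₁; inj₂)
open import Level using (0ℓ)
open import Relation.Binary.PropositionalEquality
open import Relation.Nullary.Decidable using (dec⇒maybe)
open import Tactic.RingSolver using (solve-∀)
open import Tactic.RingSolver.Core.AlmostCommutativeRing using (AlmostCommutativeRing; fromCommutativeRing)

open import Defs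

ℚ-ring : AlmostCommutativeRing 0ℓ 0ℓ
ℚ-ring = fromCommutativeRing ℚP.+-*-commutativeRing (λ q → dec⇒maybe (0ℚ ℚP.≟ q))

x≡x+y-y : ∀ x y → x ≡ x + y - y
x≡x+y-y = solve-∀ ℚ-ring

[m*n]^k≡m^k*n^k : ∀ m n k → (m ℕ.* n) ^ k ≡ m ^ k ℕ.* n ^ k
[m*n]^k≡m^k*n^k m n zero    = refl
[m*n]^k≡m^k*n^k m n (suc k) = trans (cong ((m ℕ.* n) ℕ.*_) ([m*n]^k≡m^k*n^k m n k)) (interchange m n (m ^ k) (n ^ k))
  where
  interchange : ∀ x y a b → (x ℕ.* y) ℕ.* (a ℕ.* b) ≡ (x ℕ.* a) ℕ.* (y ℕ.* b)
  interchange = solve-∀ ℕ-Ring.ring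

[1+a]*[2+a]≤2*[1+a]^s : ∀ a {s} → 2 ℕ.≤ s → suc a ℕ.* suc (suc a) ℕ.≤ 2 ℕ.* suc a ^ s
[1+a]*[2+a]≤2*[1+a]^s a (ℕ.s≤s (ℕ.s≤s {n = s} _)) = begin
  A ℕ.* suc A                  ≤⟨ ℕP.*-monoʳ-≤ A (ℕ.s≤s (ℕP.m≤n+m A a)) ⟩
  A ℕ.* (A ℕ.+ A)              ≡⟨ regroup A ⟩
  2 ℕ.* (A ℕ.* A)              ≤⟨ ℕP.*-monoʳ-≤ 2 (ℕP.*-monoʳ-≤ A (ℕP.m≤m*n A (A ^ s) {{ℕP.m^n≢0 A s}})) ⟩
  2 ℕ.* (A ℕ.* (A ℕ.* A ^ s))  ∎
  where
  open ℕP.≤-Reasoning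
  A = suc a
  regroup : ∀ x → x ℕ.* (x ℕ.+ x) ≡ 2 ℕ.* (x ℕ.* x)
  regroup = solve-∀ ℕ-Ring.ring

double : ℕ → ℕ
double zero    = zero
double (suc n) = suc (suc (double n))

double≡n+n : ∀ n → double n ≡ n ℕ.+ n
double≡n+n zero    = refl
double≡n+n (suc n) = cong suc (trans (cong suc (double≡n+n n)) (sym (ℕP.+-suc n n)))

parity : ∀ n → ∃ λ h → n ≡ double h ⊎ n ≡ suc (double h)
parity zero = zero , inj₁ refl
parity (suc n) with parity n
... | h , inj₁ n≡2h   = h , inj₂ (cong suc n≡2h)
... | h , inj₂ n≡2h+1 = suc h , inj₁ (cong suc n≡2h+1)

[1+k]*[1+n]C[1+k]≡[1+n]*nCk : ∀ n k → suc k ℕ.* (suc n C suc k) ≡ suc n ℕ.* (n C k)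
[1+k]*[1+n]C[1+k]≡[1+n]*nCk zero    zero    = refl
[1+k]*[1+n]C[1+k]≡[1+n]*nCk zero    (suc k) = ℕP.*-zeroʳ (suc (suc k))
[1+k]*[1+n]C[1+k]≡[1+n]*nCk (suc n) zero    =
  trans (ℕP.*-identityˡ _) (trans (nC1≡n (suc (suc n))) (sym (ℕP.*-identityʳ (suc (suc n)))))
[1+k]*[1+n]C[1+k]≡[1+n]*nCk (suc n) (suc k) = begin
  suc (suc k) ℕ.* (suc (suc n) C suc (suc k))   ≡⟨ cong (suc (suc k) ℕ.*_) (pascal (suc n) (suc k)) ⟨
  suc (suc k) ℕ.* (X ℕ.+ Y)                     ≡⟨ expand (suc k) X Y ⟩
  suc k ℕ.* X ℕ.+ X ℕ.+ suc (suc k) ℕ.* Y       ≡⟨ cong₂ (λ u v → u ℕ.+ X ℕ.+ v) ([1+k]*[1+n]C[1+k]≡[1+n]*nCk n k)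
                                                                                  ([1+k]*[1+n]C[1+k]≡[1+n]*nCk n (suc k)) ⟩
  suc n ℕ.* (n C k) ℕ.+ X ℕ.+ suc n ℕ.* (n C suc k)   ≡⟨ collect (suc n) (n C k) X (n C suc k) ⟩
  suc n ℕ.* (n C k ℕ.+ n C suc k) ℕ.+ X         ≡⟨ cong (λ u → suc n ℕ.* u ℕ.+ X) (pascal n k) ⟩
  suc n ℕ.* X ℕ.+ X                             ≡⟨ ℕP.+-comm (suc n ℕ.* X) X ⟩
  suc (suc n) ℕ.* X                             ∎
  where
  open ≡-Reasoning
  pascal = nCk+nC[k+1]≡[n+1]C[k+1]
  X = suc n C suc k
  Y = suc n C suc (suc k)
  expand : ∀ s x y → suc s ℕ.* (x ℕ.+ y) ≡ s ℕ.* x ℕ.+ x ℕ.+ suc s ℕ.* y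
  expand = solve-∀ ℕ-Ring.ring
  collect : ∀ p a x b → p ℕ.* a ℕ.+ x ℕ.+ p ℕ.* b ≡ p ℕ.* (a ℕ.+ b) ℕ.+ x
  collect = solve-∀ ℕ-Ring.ring

binomPrefix : ℕ → ℕ → ℕ
binomPrefix n zero    = 0
binomPrefix n (suc k) = binomPrefix n k ℕ.+ n C k

binomPrefix-pascal : ∀ n k → binomPrefix (suc n) (suc k) ℕ.+ n C k ≡ binomPrefix n (suc k) ℕ.+ binomPrefix n (suc k)
binomPrefix-pascal n zero    = refl
binomPrefix-pascal n (suc k) = begin
  (B′ ℕ.+ suc n C suc k) ℕ.+ n C suc k                   ≡⟨ cong (λ u → (B′ ℕ.+ u) ℕ.+ n C suc k) (nCk+nC[k+1]≡[n+1]C[k+1] n k) ⟨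
  (B′ ℕ.+ (n C k ℕ.+ n C suc k)) ℕ.+ n C suc k           ≡⟨ regroup B′ (n C k) (n C suc k) ⟩
  (B′ ℕ.+ n C k) ℕ.+ (n C suc k ℕ.+ n C suc k)           ≡⟨ cong (ℕ._+ (n C suc k ℕ.+ n C suc k)) (binomPrefix-pascal n k) ⟩
  (B ℕ.+ B) ℕ.+ (n C suc k ℕ.+ n C suc k)                ≡⟨ interchange B (n C suc k) ⟩
  (B ℕ.+ n C suc k) ℕ.+ (B ℕ.+ n C suc k)                ∎
  where
  open ≡-Reasoning
  B′ = binomPrefix (suc n) (suc k)
  B  = binomPrefix n (suc k)
  regroup : ∀ x a b → (x ℕ.+ (a ℕ.+ b)) ℕ.+ b ≡ (x ℕ.+ a) ℕ.+ (b ℕ.+ b)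
  regroup = solve-∀ ℕ-Ring.ring
  interchange : ∀ x y → (x ℕ.+ x) ℕ.+ (y ℕ.+ y) ≡ (x ℕ.+ y) ℕ.+ (x ℕ.+ y)
  interchange = solve-∀ ℕ-Ring.ring

binomPrefix-total : ∀ n → binomPrefix n (suc n) ≡ 2 ^ n
binomPrefix-total zero    = refl
binomPrefix-total (suc n) = begin
  binomPrefix (suc n) (suc (suc n))                          ≡⟨ ℕP.+-identityʳ _ ⟨
  binomPrefix (suc n) (suc (suc n)) ℕ.+ 0                    ≡⟨ cong (binomPrefix (suc n) (suc (suc n)) ℕ.+_) nC[1+n]≡0 ⟨
  binomPrefix (suc n) (suc (suc n)) ℕ.+ n C suc n            ≡⟨ binomPrefix-pascal n (suc n) ⟩
  binomPrefix n (suc (suc n)) ℕ.+ binomPrefix n (suc (suc n)) ≡⟨ cong (λ u → u ℕ.+ u) prefix[2+n]≡2^n ⟩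
  2 ^ n ℕ.+ 2 ^ n                                            ≡⟨ cong (2 ^ n ℕ.+_) (ℕP.+-identityʳ (2 ^ n)) ⟨
  2 ^ suc n                                                  ∎
  where
  open ≡-Reasoning
  nC[1+n]≡0 : n C suc n ≡ 0
  nC[1+n]≡0 = k>n⇒nCk≡0 (ℕP.n<1+n n)
  prefix[2+n]≡2^n : binomPrefix n (suc (suc n)) ≡ 2 ^ n
  prefix[2+n]≡2^n = trans (cong (binomPrefix n (suc n) ℕ.+_) nC[1+n]≡0)
                       (trans (ℕP.+-identityʳ _) (binomPrefix-total n))

*-monoˡ-≤-0≤ : ∀ {r p q} → 0ℚ ≤ r → p ≤ q → r * p ≤ r * q
*-monoˡ-≤-0≤ {r} 0≤r = ℚP.*-monoˡ-≤-nonNeg r {{ℚ.nonNegative 0≤r}}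

*-monoʳ-≤-0≤ : ∀ {r p q} → 0ℚ ≤ r → p ≤ q → p * r ≤ q * r
*-monoʳ-≤-0≤ {r} 0≤r = ℚP.*-monoʳ-≤-nonNeg r {{ℚ.nonNegative 0≤r}}

0≤* : ∀ {p q} → 0ℚ ≤ p → 0ℚ ≤ q → 0ℚ ≤ p * q
0≤* {p} {q} 0≤p 0≤q = ℚP.≤-trans (ℚP.≤-reflexive (sym (ℚP.*-zeroʳ p))) (*-monoˡ-≤-0≤ 0≤p 0≤q)

p-q≤p : ∀ p {q} → 0ℚ ≤ q → p - q ≤ p
p-q≤p p 0≤q = ℚP.≤-trans (ℚP.+-monoʳ-≤ p (ℚP.neg-antimono-≤ 0≤q)) (ℚP.≤-reflexive (ℚP.+-identityʳ p))

p≤q⇒∣p-q∣≡q-p : ∀ {p q} → p ≤ q → ∣ p - q ∣ ≡ q - p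
p≤q⇒∣p-q∣≡q-p {p} {q} p≤q = begin
  ∣ p - q ∣       ≡⟨ cong ∣_∣ (p-q≡-[q-p] p q) ⟩
  ∣ - (q - p) ∣   ≡⟨ ℚP.∣-p∣≡∣p∣ (q - p) ⟩
  ∣ q - p ∣       ≡⟨ ℚP.0≤p⇒∣p∣≡p 0≤q-p ⟩
  q - p           ∎
  where
  open ≡-Reasoning
  p-q≡-[q-p] : ∀ p q → p - q ≡ - (q - p)
  p-q≡-[q-p] = solve-∀ ℚ-ring
  0≤q-p : 0ℚ ≤ q - p
  0≤q-p = ℚP.≤-trans (ℚP.≤-reflexive (sym (ℚP.+-inverseʳ p))) (ℚP.+-monoˡ-≤ (- p) p≤q)

∣sign∣≡1 : ∀ j → ∣ sign j ∣ ≡ 1ℚ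
∣sign∣≡1 zero    = refl
∣sign∣≡1 (suc j) = trans (ℚP.∣-p∣≡∣p∣ (sign j)) (∣sign∣≡1 j)

sign-double : ∀ h → sign (double h) ≡ 1ℚ
sign-double zero    = refl
sign-double (suc h) = trans (neg-involutive (sign (double h))) (sign-double h)
  where
  neg-involutive : ∀ x → - - x ≡ x
  neg-involutive = solve-∀ ℚ-ring

fromℕ : ℕ → ℚ
fromℕ n = + n / 1

1/ℕ : (n : ℕ) → .{{NonZero n}} → ℚ
1/ℕ n = + 1 / n

toℚᵘ-/ : ∀ a c .{{_ : NonZero c}} → toℚᵘ (+ a / c) ≃ᵘ mkℚᵘ (+ a) (ℕ.pred c)
toℚᵘ-/ a (suc c) = ℚP.toℚᵘ-fromℚᵘ (mkℚᵘ (+ a) c)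

fromℕ-+ : ∀ a b → fromℕ (a ℕ.+ b) ≡ fromℕ a + fromℕ b
fromℕ-+ a b = ℚP.toℚᵘ-injective (begin
  toℚᵘ (fromℕ (a ℕ.+ b))                ≈⟨ toℚᵘ-/ (a ℕ.+ b) 1 ⟩
  mkℚᵘ (+ (a ℕ.+ b)) 0                  ≈⟨ *≡* cast ⟩
  mkℚᵘ (+ a) 0 ℚᵘ.+ mkℚᵘ (+ b) 0        ≈⟨ ℚᵘP.+-cong (toℚᵘ-/ a 1) (toℚᵘ-/ b 1) ⟨
  toℚᵘ (fromℕ a) ℚᵘ.+ toℚᵘ (fromℕ b)    ≈⟨ ℚP.toℚᵘ-homo-+ (fromℕ a) (fromℕ b) ⟨
  toℚᵘ (fromℕ a + fromℕ b)              ∎)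
  where
  open ℚᵘP.≃-Reasoning
  cast : + (a ℕ.+ b) ℤ.* + 1 ≡ (+ a ℤ.* + 1 ℤ.+ + b ℤ.* + 1) ℤ.* + 1
  cast rewrite ℤP.*-identityʳ (+ a) | ℤP.*-identityʳ (+ b) = refl

fromℕ-* : ∀ a b → fromℕ (a ℕ.* b) ≡ fromℕ a * fromℕ b
fromℕ-* a b = ℚP.toℚᵘ-injective (begin
  toℚᵘ (fromℕ (a ℕ.* b))                ≈⟨ toℚᵘ-/ (a ℕ.* b) 1 ⟩
  mkℚᵘ (+ (a ℕ.* b)) 0                  ≈⟨ *≡* (cong (ℤ._* + 1) (ℤP.pos-* a b)) ⟩
  mkℚᵘ (+ a) 0 ℚᵘ.* mkℚᵘ (+ b) 0        ≈⟨ ℚᵘP.*-cong (toℚᵘ-/ a 1) (toℚᵘ-/ b 1) ⟨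
  toℚᵘ (fromℕ a) ℚᵘ.* toℚᵘ (fromℕ b)    ≈⟨ ℚP.toℚᵘ-homo-* (fromℕ a) (fromℕ b) ⟨
  toℚᵘ (fromℕ a * fromℕ b)              ∎)
  where open ℚᵘP.≃-Reasoning

/≡fromℕ*1/ℕ : ∀ a c .{{_ : NonZero c}} → + a / c ≡ fromℕ a * 1/ℕ c
/≡fromℕ*1/ℕ a c@(suc c-1) = ℚP.toℚᵘ-injective (begin
  toℚᵘ (+ a / c)                        ≈⟨ toℚᵘ-/ a c ⟩
  mkℚᵘ (+ a) c-1                        ≈⟨ *≡* cast ⟩
  mkℚᵘ (+ a) 0 ℚᵘ.* mkℚᵘ (+ 1) c-1      ≈⟨ ℚᵘP.*-cong (toℚᵘ-/ a 1) (toℚᵘ-/ 1 c) ⟨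
  toℚᵘ (fromℕ a) ℚᵘ.* toℚᵘ (1/ℕ c)      ≈⟨ ℚP.toℚᵘ-homo-* (fromℕ a) (1/ℕ c) ⟨
  toℚᵘ (fromℕ a * 1/ℕ c)                ∎)
  where
  open ℚᵘP.≃-Reasoning
  cast : + a ℤ.* + (suc (c-1 ℕ.+ 0)) ≡ (+ a ℤ.* + 1) ℤ.* + c
  cast rewrite ℕP.+-identityʳ c-1 | ℤP.*-identityʳ (+ a) = refl

0≤fromℕ : ∀ n → 0ℚ ≤ fromℕ n
0≤fromℕ n = ℚP.nonNegative⁻¹ (fromℕ n) {{ℚP.normalize-nonNeg n 1}}

0≤1/ℕ : ∀ n .{{_ : NonZero n}} → 0ℚ ≤ 1/ℕ n
0≤1/ℕ n = ℚP.nonNegative⁻¹ (1/ℕ n) {{ℚP.normalize-nonNeg 1 n}}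

cross-≤ : ∀ a b c d .{{_ : NonZero c}} .{{_ : NonZero d}} →
          a ℕ.* d ℕ.≤ b ℕ.* c → fromℕ a * 1/ℕ c ≤ fromℕ b * 1/ℕ d
cross-≤ a b c@(suc _) d@(suc _) ad≤bc
  rewrite sym (/≡fromℕ*1/ℕ a c) | sym (/≡fromℕ*1/ℕ b d) =
  ℚP.toℚᵘ-cancel-≤ (ℚᵘP.≤-respˡ-≃ (ℚᵘP.≃-sym (toℚᵘ-/ a c))
                    (ℚᵘP.≤-respʳ-≃ (ℚᵘP.≃-sym (toℚᵘ-/ b d)) (*≤* cast)))
  where
  cast : + a ℤ.* + d ℤ.≤ + b ℤ.* + c
  cast rewrite sym (ℤP.pos-* a d) | sym (ℤP.pos-* b c) = ℤ.+≤+ ad≤bc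

cross-< : ∀ a b c d .{{_ : NonZero c}} .{{_ : NonZero d}} →
          a ℕ.* d ℕ.< b ℕ.* c → fromℕ a * 1/ℕ c < fromℕ b * 1/ℕ d
cross-< a b c@(suc _) d@(suc _) ad<bc
  rewrite sym (/≡fromℕ*1/ℕ a c) | sym (/≡fromℕ*1/ℕ b d) =
  ℚP.toℚᵘ-cancel-< (ℚᵘP.<-respˡ-≃ (ℚᵘP.≃-sym (toℚᵘ-/ a c))
                    (ℚᵘP.<-respʳ-≃ (ℚᵘP.≃-sym (toℚᵘ-/ b d)) (*<* cast)))
  where
  cast : + a ℤ.* + d ℤ.< + b ℤ.* + c
  cast rewrite sym (ℤP.pos-* a d) | sym (ℤP.pos-* b c) = ℤ.+<+ ad<bc

cross-≡ : ∀ a b c d .{{_ : NonZero c}} .{{_ : NonZero d}} →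
          a ℕ.* d ≡ b ℕ.* c → fromℕ a * 1/ℕ c ≡ fromℕ b * 1/ℕ d
cross-≡ a b c d ad≡bc = ℚP.≤-antisym (cross-≤ a b c d (ℕP.≤-reflexive ad≡bc))
                                      (cross-≤ b a d c (ℕP.≤-reflexive (sym ad≡bc)))

1/ℕ-inverseˡ : ∀ n .{{_ : NonZero n}} → 1/ℕ n * fromℕ n ≡ 1ℚ
1/ℕ-inverseˡ n = begin
  1/ℕ n * fromℕ n        ≡⟨ ℚP.*-comm (1/ℕ n) (fromℕ n) ⟩
  fromℕ n * 1/ℕ n        ≡⟨ cross-≡ n 1 n 1 (ℕP.*-comm n 1) ⟩
  fromℕ 1 * 1/ℕ 1        ∎
  where open ≡-Reasoning

1/ℕ-* : ∀ a b .{{_ : NonZero a}} .{{_ : NonZero b}} →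
        1/ℕ (a ℕ.* b) {{ℕP.m*n≢0 a b}} ≡ 1/ℕ a * 1/ℕ b
1/ℕ-* a@(suc _) b@(suc _) = ℚP.toℚᵘ-injective (begin
  toℚᵘ (1/ℕ (a ℕ.* b))                       ≈⟨ toℚᵘ-/ 1 (a ℕ.* b) ⟩
  mkℚᵘ (+ 1) (ℕ.pred (a ℕ.* b))              ≈⟨ *≡* refl ⟩
  mkℚᵘ (+ 1) (ℕ.pred a) ℚᵘ.* mkℚᵘ (+ 1) (ℕ.pred b)  ≈⟨ ℚᵘP.*-cong (toℚᵘ-/ 1 a) (toℚᵘ-/ 1 b) ⟨
  toℚᵘ (1/ℕ a) ℚᵘ.* toℚᵘ (1/ℕ b)             ≈⟨ ℚP.toℚᵘ-homo-* (1/ℕ a) (1/ℕ b) ⟨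
  toℚᵘ (1/ℕ a * 1/ℕ b)                       ∎)
  where open ℚᵘP.≃-Reasoning

fromℕ-∸ : ∀ a b → b ℕ.≤ a → fromℕ (a ℕ.∸ b) ≡ fromℕ a - fromℕ b
fromℕ-∸ a b b≤a = begin
  fromℕ (a ℕ.∸ b)                       ≡⟨ x≡x+y-y (fromℕ (a ℕ.∸ b)) (fromℕ b) ⟩
  fromℕ (a ℕ.∸ b) + fromℕ b - fromℕ b   ≡⟨ cong (_- fromℕ b) (fromℕ-+ (a ℕ.∸ b) b) ⟨
  fromℕ (a ℕ.∸ b ℕ.+ b) - fromℕ b       ≡⟨ cong (λ n → fromℕ n - fromℕ b) (ℕP.m∸n+n≡m b≤a) ⟩
  fromℕ a - fromℕ b                     ∎
  where
  open ≡-Reasoning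

1/ℕ-telescope : ∀ a .{{_ : NonZero a}} → 1/ℕ a - 1/ℕ (suc a) ≡ 1/ℕ (a ℕ.* suc a) {{ℕP.m*n≢0 a (suc a)}}
1/ℕ-telescope a = begin
  x - y                                                    ≡⟨ cong₂ _-_ (ℚP.*-identityʳ x) (ℚP.*-identityʳ y) ⟨
  x * 1ℚ - y * 1ℚ                                          ≡⟨ cong₂ (λ p q → x * p - y * q) (1/ℕ-inverseˡ (suc a)) (1/ℕ-inverseˡ a) ⟨
  x * (y * fromℕ (suc a)) - y * (x * fromℕ a)              ≡⟨ cong (λ p → x * (y * p) - y * (x * fromℕ a)) (fromℕ-+ 1 a) ⟩
  x * (y * (1ℚ + fromℕ a)) - y * (x * fromℕ a)             ≡⟨ cancel x y (fromℕ a) ⟩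
  x * y                                                    ≡⟨ 1/ℕ-* a (suc a) ⟨
  1/ℕ (a ℕ.* suc a) {{ℕP.m*n≢0 a (suc a)}}                 ∎
  where
  open ≡-Reasoning
  x = 1/ℕ a
  y = 1/ℕ (suc a)
  cancel : ∀ x y z → x * (y * (1ℚ + z)) - y * (x * z) ≡ x * y
  cancel = solve-∀ ℚ-ring

recip : ℕ → ℚ
recip zero    = 0ℚ
recip (suc k) = 1/ℕ (suc k)

½^ : ℕ → ℚ
½^ n = 1/ℕ (2 ^ n) {{ℕP.m^n≢0 2 n}}

½^-inverse : ∀ n → ½^ n * fromℕ (2 ^ n) ≡ 1ℚ
½^-inverse n = 1/ℕ-inverseˡ (2 ^ n) {{ℕP.m^n≢0 2 n}}

½^-suc : ∀ n → ½^ (suc n) * fromℕ 2 ≡ ½^ n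
½^-suc n = trans (cong (_* fromℕ 2) (1/ℕ-* 2 (2 ^ n) {{_}} {{ℕP.m^n≢0 2 n}})) (half*x*2≡x (½^ n))
  where
  half*x*2≡x : ∀ x → (1/ℕ 2 * x) * fromℕ 2 ≡ x
  half*x*2≡x = solve-∀ ℚ-ring

sumFrom1-cong : ∀ {f g : ℕ → ℚ} → (∀ j → f (suc j) ≡ g (suc j)) → ∀ n → sumFrom1 n f ≡ sumFrom1 n g
sumFrom1-cong f≗g zero    = refl
sumFrom1-cong f≗g (suc n) = cong₂ _+_ (sumFrom1-cong f≗g n) (f≗g n)

sumFrom1-minus : ∀ (f g : ℕ → ℚ) n → sumFrom1 n (λ k → f k - g k) ≡ sumFrom1 n f - sumFrom1 n g
sumFrom1-minus f g zero    = refl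
sumFrom1-minus f g (suc n) = trans (cong (_+ (f (suc n) - g (suc n))) (sumFrom1-minus f g n))
                               (interchange (sumFrom1 n f) (sumFrom1 n g) (f (suc n)) (g (suc n)))
  where
  interchange : ∀ a b c d → (a - b) + (c - d) ≡ (a + c) - (b + d)
  interchange = solve-∀ ℚ-ring

sumFrom1-* : ∀ c (f : ℕ → ℚ) n → sumFrom1 n (λ k → c * f k) ≡ c * sumFrom1 n f
sumFrom1-* c f zero    = sym (ℚP.*-zeroʳ c)
sumFrom1-* c f (suc n) = trans (cong (_+ c * f (suc n)) (sumFrom1-* c f n))
                               (sym (ℚP.*-distribˡ-+ c (sumFrom1 n f) (f (suc n))))

sumFrom1-mono-≤ : ∀ {f g : ℕ → ℚ} → (∀ j → f (suc j) ≤ g (suc j)) → ∀ n → sumFrom1 n f ≤ sumFrom1 n g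
sumFrom1-mono-≤ f≤g zero    = ℚP.≤-refl
sumFrom1-mono-≤ f≤g (suc n) = ℚP.+-mono-≤ (sumFrom1-mono-≤ f≤g n) (f≤g n)

∣sumFrom1∣≤sumFrom1∣∣ : ∀ (f : ℕ → ℚ) n → ∣ sumFrom1 n f ∣ ≤ sumFrom1 n (λ k → ∣ f k ∣)
∣sumFrom1∣≤sumFrom1∣∣ f zero    = ℚP.≤-refl
∣sumFrom1∣≤sumFrom1∣∣ f (suc n) =
  ℚP.≤-trans (ℚP.∣p+q∣≤∣p∣+∣q∣ (sumFrom1 n f) (f (suc n)))
             (ℚP.+-monoˡ-≤ ∣ f (suc n) ∣ (∣sumFrom1∣≤sumFrom1∣∣ f n))

sumFrom1-monoʳ-≤ : ∀ {f : ℕ → ℚ} → (∀ j → 0ℚ ≤ f (suc j)) → ∀ a d → sumFrom1 a f ≤ sumFrom1 (d ℕ.+ a) f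
sumFrom1-monoʳ-≤ f≥0 a zero    = ℚP.≤-refl
sumFrom1-monoʳ-≤ {f} f≥0 a (suc d) = begin
  sumFrom1 a f                             ≡⟨ ℚP.+-identityʳ (sumFrom1 a f) ⟨
  sumFrom1 a f + 0ℚ                        ≤⟨ ℚP.+-mono-≤ (sumFrom1-monoʳ-≤ f≥0 a d) (f≥0 (d ℕ.+ a)) ⟩
  sumFrom1 (d ℕ.+ a) f + f (suc d ℕ.+ a)   ∎
  where open ℚP.≤-Reasoning

sumFrom1-telescope-≤ : ∀ {f g : ℕ → ℚ} → (∀ j → f (suc j) ≤ g j - g (suc j)) →
                       ∀ a d → sumFrom1 (d ℕ.+ a) f - sumFrom1 a f ≤ g a - g (d ℕ.+ a)
sumFrom1-telescope-≤ {f} {g} f≤Δg a zero = ℚP.≤-reflexive (x-x≡y-y (sumFrom1 a f) (g a))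
  where
  x-x≡y-y : ∀ x y → x - x ≡ y - y
  x-x≡y-y = solve-∀ ℚ-ring
sumFrom1-telescope-≤ {f} {g} f≤Δg a (suc d) = begin
  (F + f (suc d ℕ.+ a)) - F₀          ≡⟨ regroup F (f (suc d ℕ.+ a)) F₀ ⟩
  (F - F₀) + f (suc d ℕ.+ a)          ≤⟨ ℚP.+-mono-≤ (sumFrom1-telescope-≤ {f} {g} f≤Δg a d) (f≤Δg (d ℕ.+ a)) ⟩
  (g a - G) + (G - g (suc d ℕ.+ a))   ≡⟨ telescope (g a) G (g (suc d ℕ.+ a)) ⟩
  g a - g (suc d ℕ.+ a)               ∎
  where
  open ℚP.≤-Reasoning
  F  = sumFrom1 (d ℕ.+ a) f
  F₀ = sumFrom1 a f
  G  = g (d ℕ.+ a)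
  regroup : ∀ x y z → (x + y) - z ≡ (x - z) + y
  regroup = solve-∀ ℚ-ring
  telescope : ∀ x y z → (x - y) + (y - z) ≡ x - z
  telescope = solve-∀ ℚ-ring

summation-by-parts : ∀ (b v : ℕ → ℚ) n →
  sumFrom1 n (λ k → b k * (v k - v (suc k))) + b n * v (suc n) ≡
  sumFrom1 n (λ k → (b k - b (ℕ.pred k)) * v k) + b 0 * v 1
summation-by-parts b v zero    = refl
summation-by-parts b v (suc n) = begin
  (L + b (suc n) * (v (suc n) - v (suc (suc n)))) + b (suc n) * v (suc (suc n))
    ≡⟨ shift L (b n) (b (suc n)) (v (suc n)) (v (suc (suc n))) ⟩
  (L + b n * v (suc n)) + (b (suc n) - b n) * v (suc n)
    ≡⟨ cong (_+ (b (suc n) - b n) * v (suc n)) (summation-by-parts b v n) ⟩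
  (R + b 0 * v 1) + (b (suc n) - b n) * v (suc n)
    ≡⟨ swap R (b 0 * v 1) ((b (suc n) - b n) * v (suc n)) ⟩
  (R + (b (suc n) - b n) * v (suc n)) + b 0 * v 1
    ∎
  where
  open ≡-Reasoning
  L = sumFrom1 n (λ k → b k * (v k - v (suc k)))
  R = sumFrom1 n (λ k → (b k - b (ℕ.pred k)) * v k)
  shift : ∀ l b₀ b₁ v₁ v₂ → (l + b₁ * (v₁ - v₂)) + b₁ * v₂ ≡ (l + b₀ * v₁) + (b₁ - b₀) * v₁
  shift = solve-∀ ℚ-ring
  swap : ∀ x y z → (x + y) + z ≡ (x + z) + y
  swap = solve-∀ ℚ-ring

fromℕ-binomPrefix : ∀ n k → fromℕ (binomPrefix n (suc k)) ≡ 1ℚ + sumFrom1 k (λ i → fromℕ (n C i))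
fromℕ-binomPrefix n zero    = refl
fromℕ-binomPrefix n (suc k) = begin
  fromℕ (binomPrefix n (suc k) ℕ.+ n C suc k)          ≡⟨ fromℕ-+ (binomPrefix n (suc k)) (n C suc k) ⟩
  fromℕ (binomPrefix n (suc k)) + fromℕ (n C suc k)    ≡⟨ cong (_+ fromℕ (n C suc k)) (fromℕ-binomPrefix n k) ⟩
  (1ℚ + Σ) + fromℕ (n C suc k)                         ≡⟨ ℚP.+-assoc 1ℚ Σ (fromℕ (n C suc k)) ⟩
  1ℚ + (Σ + fromℕ (n C suc k))                         ∎
  where
  open ≡-Reasoning
  Σ = sumFrom1 k (λ i → fromℕ (n C i))

1+sumFrom1-C≡2^ : ∀ n → 1ℚ + sumFrom1 n (λ k → fromℕ (n C k)) ≡ fromℕ (2 ^ n)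
1+sumFrom1-C≡2^ n = trans (sym (fromℕ-binomPrefix n n)) (cong fromℕ (binomPrefix-total n))

fromℕ-binomPrefix-pascal : ∀ n j → fromℕ (binomPrefix (suc n) (suc j))
                                   ≡ fromℕ 2 * fromℕ (binomPrefix n (suc j)) - fromℕ (n C j)
fromℕ-binomPrefix-pascal n j = begin
  fromℕ B′                    ≡⟨ x≡x+y-y (fromℕ B′) (fromℕ c) ⟩
  fromℕ B′ + fromℕ c - fromℕ c ≡⟨ cong (_- fromℕ c) (fromℕ-+ B′ c) ⟨
  fromℕ (B′ ℕ.+ c) - fromℕ c  ≡⟨ cong (λ u → fromℕ u - fromℕ c) (binomPrefix-pascal n j) ⟩
  fromℕ (B ℕ.+ B) - fromℕ c   ≡⟨ cong (_- fromℕ c) (fromℕ-+ B B) ⟩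
  fromℕ B + fromℕ B - fromℕ c ≡⟨ doubling (fromℕ B) (fromℕ c) ⟩
  fromℕ 2 * fromℕ B - fromℕ c ∎
  where
  open ≡-Reasoning
  B′ = binomPrefix (suc n) (suc j)
  B  = binomPrefix n (suc j)
  c  = n C j
  doubling : ∀ x y → x + x - y ≡ fromℕ 2 * x - y
  doubling = solve-∀ ℚ-ring

nCk/[1+k]≡[1+n]C[1+k]/[1+n] : ∀ n k → fromℕ (n C k) * 1/ℕ (suc k) ≡ fromℕ (suc n C suc k) * 1/ℕ (suc n)
nCk/[1+k]≡[1+n]C[1+k]/[1+n] n k = cross-≡ (n C k) (suc n C suc k) (suc k) (suc n) (begin
  (n C k) ℕ.* suc n           ≡⟨ ℕP.*-comm (n C k) (suc n) ⟩
  suc n ℕ.* (n C k)           ≡⟨ [1+k]*[1+n]C[1+k]≡[1+n]*nCk n k ⟨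
  suc k ℕ.* (suc n C suc k)   ≡⟨ ℕP.*-comm (suc k) (suc n C suc k) ⟩
  (suc n C suc k) ℕ.* suc k   ∎)
  where open ≡-Reasoning

sumFrom1-C≤2^ : ∀ n → sumFrom1 n (λ k → fromℕ (suc n C k)) ≤ fromℕ (2 ^ suc n)
sumFrom1-C≤2^ n = begin
  sumFrom1 n f                ≤⟨ sumFrom1-monoʳ-≤ (λ k → 0≤fromℕ (suc n C suc k)) n 1 ⟩
  sumFrom1 (suc n) f          ≡⟨ ℚP.+-identityˡ _ ⟨
  0ℚ + sumFrom1 (suc n) f     ≤⟨ ℚP.+-monoˡ-≤ (sumFrom1 (suc n) f) (0≤fromℕ 1) ⟩
  1ℚ + sumFrom1 (suc n) f     ≡⟨ 1+sumFrom1-C≡2^ (suc n) ⟩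
  fromℕ (2 ^ suc n)           ∎
  where
  open ℚP.≤-Reasoning
  f = λ k → fromℕ (suc n C k)

0≤invPow : ∀ j s → 0ℚ ≤ invPow j s
0≤invPow j s = 0≤1/ℕ (suc j ^ s) {{ℕP.m^n≢0 (suc j) s}}

invPow-suc : ∀ j s → invPow j (suc s) ≡ 1/ℕ (suc j) * invPow j s
invPow-suc j s = 1/ℕ-* (suc j) (suc j ^ s) {{_}} {{ℕP.m^n≢0 (suc j) s}}

invPow-scale : ∀ k i j s → suc i ≡ k ℕ.* suc j → fromℕ (k ^ s) * invPow i s ≡ invPow j s
invPow-scale k i j s 1+i≡k[1+j] = begin
  fromℕ (k ^ s) * 1/ℕ (suc i ^ s) {{ℕP.m^n≢0 (suc i) s}}
    ≡⟨ cross-≡ (k ^ s) 1 (suc i ^ s) (suc j ^ s) {{ℕP.m^n≢0 (suc i) s}} {{ℕP.m^n≢0 (suc j) s}} powers ⟩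
  fromℕ 1 * invPow j s
    ≡⟨ ℚP.*-identityˡ (invPow j s) ⟩
  invPow j s
    ∎
  where
  open ≡-Reasoning
  powers : k ^ s ℕ.* suc j ^ s ≡ 1 ℕ.* suc i ^ s
  powers = begin
    k ^ s ℕ.* suc j ^ s   ≡⟨ [m*n]^k≡m^k*n^k k (suc j) s ⟨
    (k ℕ.* suc j) ^ s     ≡⟨ cong (_^ s) 1+i≡k[1+j] ⟨
    suc i ^ s             ≡⟨ ℕP.*-identityˡ (suc i ^ s) ⟨
    1 ℕ.* suc i ^ s       ∎

invPow-≤-telescope : ∀ {s} → 2 ℕ.≤ s → ∀ j → invPow j s ≤ fromℕ 2 * (recip (suc j) - recip (suc (suc j)))
invPow-≤-telescope {s} 2≤s j = begin
  invPow j s                                          ≡⟨ ℚP.*-identityˡ (invPow j s) ⟨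
  fromℕ 1 * 1/ℕ (A ^ s) {{ℕP.m^n≢0 A s}}
    ≤⟨ cross-≤ 1 2 (A ^ s) (A ℕ.* suc A) {{ℕP.m^n≢0 A s}} {{ℕP.m*n≢0 A (suc A)}} A[1+A]≤2Aˢ ⟩
  fromℕ 2 * 1/ℕ (A ℕ.* suc A) {{ℕP.m*n≢0 A (suc A)}}  ≡⟨ cong (fromℕ 2 *_) (1/ℕ-telescope A) ⟨
  fromℕ 2 * (1/ℕ A - 1/ℕ (suc A))                     ∎
  where
  open ℚP.≤-Reasoning
  A = suc j
  A[1+A]≤2Aˢ : 1 ℕ.* (A ℕ.* suc A) ℕ.≤ 2 ℕ.* A ^ s
  A[1+A]≤2Aˢ = subst (ℕ._≤ 2 ℕ.* A ^ s) (sym (ℕP.*-identityˡ _)) ([1+a]*[2+a]≤2*[1+a]^s j 2≤s)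

etaTerm : ℕ → ℕ → ℚ
etaTerm s zero    = 0ℚ
etaTerm s (suc j) = sign j * invPow j s

etaPartial : ℕ → ℕ → ℚ
etaPartial s n = sumFrom1 n (etaTerm s)

rhsTerm : ℕ → ℕ → ℚ
rhsTerm s n = ½^ (suc n) * sumFrom1 (suc n) (λ k → etaTerm s k * fromℕ (n C ℕ.pred k))

defect : ℕ → ℕ → ℚ
defect s n = ½^ n * sumFrom1 n (λ k → etaTerm s k * fromℕ (binomPrefix n k))

S/[n2ⁿ]≡rhsTerm : ∀ m n →
  S (suc n) m * 1/ℕ (suc n ℕ.* 2 ^ suc n) {{ℕP.m*n≢0 (suc n) (2 ^ suc n) {{_}} {{ℕP.m^n≢0 2 (suc n)}}}}
    ≡ rhsTerm (suc m) n
S/[n2ⁿ]≡rhsTerm m n = begin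
  S (suc n) m * 1/ℕ (suc n ℕ.* 2 ^ suc n) {{ℕP.m*n≢0 (suc n) (2 ^ suc n) {{_}} {{ℕP.m^n≢0 2 (suc n)}}}}
    ≡⟨ cong (S (suc n) m *_) (1/ℕ-* (suc n) (2 ^ suc n) {{_}} {{ℕP.m^n≢0 2 (suc n)}}) ⟩
  S (suc n) m * (1/ℕ (suc n) * ½^ (suc n))
    ≡⟨ rearrange (S (suc n) m) (1/ℕ (suc n)) (½^ (suc n)) ⟩
  ½^ (suc n) * (1/ℕ (suc n) * S (suc n) m)
    ≡⟨ cong (½^ (suc n) *_) (sumFrom1-* (1/ℕ (suc n)) _ (suc n)) ⟨
  ½^ (suc n) * sumFrom1 (suc n) _
    ≡⟨ cong (½^ (suc n) *_) (sumFrom1-cong absorb (suc n)) ⟩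
  rhsTerm (suc m) n
    ∎
  where
  open ≡-Reasoning
  rearrange : ∀ x y z → x * (y * z) ≡ z * (y * x)
  rearrange = solve-∀ ℚ-ring
  absorb : ∀ j → 1/ℕ (suc n) * (fromℕ (suc n C suc j) * sign j * invPow j m)
                 ≡ etaTerm (suc m) (suc j) * fromℕ (n C j)
  absorb j = begin
    1/ℕ (suc n) * (fromℕ (suc n C suc j) * sign j * invPow j m)
      ≡⟨ regroup (1/ℕ (suc n)) (fromℕ (suc n C suc j)) (sign j) (invPow j m) ⟩
    sign j * invPow j m * (fromℕ (suc n C suc j) * 1/ℕ (suc n))
      ≡⟨ cong (sign j * invPow j m *_) (nCk/[1+k]≡[1+n]C[1+k]/[1+n] n j) ⟨
    sign j * invPow j m * (fromℕ (n C j) * 1/ℕ (suc j))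
      ≡⟨ regroup′ (sign j) (invPow j m) (fromℕ (n C j)) (1/ℕ (suc j)) ⟩
    sign j * (1/ℕ (suc j) * invPow j m) * fromℕ (n C j)
      ≡⟨ cong (λ w → sign j * w * fromℕ (n C j)) (invPow-suc j m) ⟨
    sign j * invPow j (suc m) * fromℕ (n C j)
      ∎
    where
    regroup : ∀ r c s w → r * (c * s * w) ≡ s * w * (c * r)
    regroup = solve-∀ ℚ-ring
    regroup′ : ∀ s w c r → s * w * (c * r) ≡ s * (r * w) * c
    regroup′ = solve-∀ ℚ-ring

defect-suc : ∀ s n → defect s (suc n) ≡ defect s n + etaTerm s (suc n) - rhsTerm s n
defect-suc s n = begin
  ½^ (suc n) * sumFrom1 (suc n) (λ k → e k * fromℕ (binomPrefix (suc n) k))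
    ≡⟨ cong (½^ (suc n) *_) (sumFrom1-cong pascal (suc n)) ⟩
  ½^ (suc n) * sumFrom1 (suc n) (λ k → fromℕ 2 * (e k * fromℕ (binomPrefix n k)) - e k * c k)
    ≡⟨ cong (½^ (suc n) *_) (sumFrom1-minus _ _ (suc n)) ⟩
  ½^ (suc n) * (sumFrom1 (suc n) (λ k → fromℕ 2 * (e k * fromℕ (binomPrefix n k))) - Σc)
    ≡⟨ cong (λ u → ½^ (suc n) * (u - Σc)) (sumFrom1-* (fromℕ 2) _ (suc n)) ⟩
  ½^ (suc n) * (fromℕ 2 * (X + e (suc n) * fromℕ (binomPrefix n (suc n))) - Σc)
    ≡⟨ cong (λ u → ½^ (suc n) * (fromℕ 2 * (X + e (suc n) * fromℕ u) - Σc)) (binomPrefix-total n) ⟩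
  ½^ (suc n) * (fromℕ 2 * (X + e (suc n) * fromℕ (2 ^ n)) - Σc)
    ≡⟨ expand (½^ (suc n)) (fromℕ 2) X (e (suc n)) (fromℕ (2 ^ n)) Σc ⟩
  (½^ (suc n) * fromℕ 2) * X + e (suc n) * ((½^ (suc n) * fromℕ 2) * fromℕ (2 ^ n)) - ½^ (suc n) * Σc
    ≡⟨ cong (λ h → h * X + e (suc n) * (h * fromℕ (2 ^ n)) - ½^ (suc n) * Σc) (½^-suc n) ⟩
  ½^ n * X + e (suc n) * (½^ n * fromℕ (2 ^ n)) - ½^ (suc n) * Σc
    ≡⟨ cong (λ u → ½^ n * X + e (suc n) * u - ½^ (suc n) * Σc) (½^-inverse n) ⟩
  ½^ n * X + e (suc n) * 1ℚ - ½^ (suc n) * Σc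
    ≡⟨ cong (λ u → ½^ n * X + u - ½^ (suc n) * Σc) (ℚP.*-identityʳ (e (suc n))) ⟩
  defect s n + e (suc n) - rhsTerm s n
    ∎
  where
  open ≡-Reasoning
  e = etaTerm s
  c = λ k → fromℕ (n C ℕ.pred k)
  X = sumFrom1 n (λ k → e k * fromℕ (binomPrefix n k))
  Σc = sumFrom1 (suc n) (λ k → e k * c k)
  pascal : ∀ j → e (suc j) * fromℕ (binomPrefix (suc n) (suc j))
                 ≡ fromℕ 2 * (e (suc j) * fromℕ (binomPrefix n (suc j))) - e (suc j) * c (suc j)
  pascal j = trans (cong (e (suc j) *_) (fromℕ-binomPrefix-pascal n j))
                   (distribute (e (suc j)) (fromℕ (binomPrefix n (suc j))) (c (suc j)))
    where
    distribute : ∀ x b y → x * (fromℕ 2 * b - y) ≡ fromℕ 2 * (x * b) - x * y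
    distribute = solve-∀ ℚ-ring
  expand : ∀ h t x w p y → h * (t * (x + w * p) - y) ≡ (h * t) * x + w * ((h * t) * p) - h * y
  expand = solve-∀ ℚ-ring

rhsPartial≡etaPartial-defect : ∀ m n → rhsPartial m n ≡ etaPartial (suc m) n - defect (suc m) n
rhsPartial≡etaPartial-defect m zero    = refl
rhsPartial≡etaPartial-defect m (suc n) = begin
  rhsPartial m n + S (suc n) m * _
    ≡⟨ cong₂ _+_ (rhsPartial≡etaPartial-defect m n) (S/[n2ⁿ]≡rhsTerm m n) ⟩
  (η - E) + rhsTerm (suc m) n
    ≡⟨ regroup η E (etaTerm (suc m) (suc n)) (rhsTerm (suc m) n) ⟩
  (η + etaTerm (suc m) (suc n)) - (E + etaTerm (suc m) (suc n) - rhsTerm (suc m) n)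
    ≡⟨ cong (λ d → etaPartial (suc m) (suc n) - d) (defect-suc (suc m) n) ⟨
  etaPartial (suc m) (suc n) - defect (suc m) (suc n)
    ∎
  where
  open ≡-Reasoning
  η = etaPartial (suc m) n
  E = defect (suc m) n
  regroup : ∀ a b t r → (a - b) + r ≡ (a + t) - (b + t - r)
  regroup = solve-∀ ℚ-ring

zeta-gap : ∀ {s} → 2 ℕ.≤ s → ∀ a d {n} → d ℕ.+ a ≡ n → d ℕ.≤ suc a →
           ∣ zetaPartial s a - zetaPartial s n ∣ ≤ fromℕ 4 * recip (suc n)
zeta-gap {s} 2≤s a d refl d≤1+a = begin
  ∣ ζ a - ζ (d ℕ.+ a) ∣    ≡⟨ p≤q⇒∣p-q∣≡q-p (sumFrom1-monoʳ-≤ (λ j → 0≤invPow j s) a d) ⟩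
  ζ (d ℕ.+ a) - ζ a        ≤⟨ sumFrom1-telescope-≤ {g = g} step a d ⟩
  g a - g (d ℕ.+ a)        ≤⟨ p-q≤p (g a) (0≤* (0≤fromℕ 2) (0≤1/ℕ (suc (d ℕ.+ a)))) ⟩
  fromℕ 2 * 1/ℕ (suc a)    ≤⟨ cross-≤ 2 4 (suc a) (suc (d ℕ.+ a)) 2[1+d+a]≤4[1+a] ⟩
  fromℕ 4 * 1/ℕ (suc (d ℕ.+ a)) ∎
  where
  open ℚP.≤-Reasoning
  ζ = zetaPartial s
  g : ℕ → ℚ
  g k = fromℕ 2 * recip (suc k)
  step : ∀ j → invPow j s ≤ g j - g (suc j)
  step j = ℚP.≤-trans (invPow-≤-telescope 2≤s j) (ℚP.≤-reflexive (distrib (fromℕ 2) (recip (suc j)) (recip (suc (suc j)))))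
    where
    distrib : ∀ t x y → t * (x - y) ≡ t * x - t * y
    distrib = solve-∀ ℚ-ring
  2[1+d+a]≤4[1+a] : 2 ℕ.* suc (d ℕ.+ a) ℕ.≤ 4 ℕ.* suc a
  2[1+d+a]≤4[1+a] = ℕP.≤-trans (ℕP.*-monoʳ-≤ 2 (ℕ.s≤s (ℕP.+-monoˡ-≤ a d≤1+a))) (ℕP.≤-reflexive (2[2+x+x]≡4[1+x] a))
    where
    2[2+x+x]≡4[1+x] : ∀ x → 2 ℕ.* suc (suc x ℕ.+ x) ≡ 4 ℕ.* suc x
    2[2+x+x]≡4[1+x] = solve-∀ ℕ-Ring.ring

binomPrefix-weighted-≤ : ∀ n → sumFrom1 n (λ k → fromℕ (binomPrefix n k) * (recip k - recip (suc k)))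
                                ≤ recip (suc n) * fromℕ (2 ^ suc n)
binomPrefix-weighted-≤ n = begin
  Σ                                   ≡⟨ x≡x+y-y Σ X ⟩
  (Σ + X) - X                         ≡⟨ cong (_- X) (summation-by-parts b recip n) ⟩
  (R + b 0 * recip 1) - X             ≡⟨ cong (λ z → (R + z) - X) (ℚP.*-zeroˡ (recip 1)) ⟩
  (R + 0ℚ) - X                        ≡⟨ cong (_- X) (ℚP.+-identityʳ R) ⟩
  R - X                               ≤⟨ p-q≤p R (0≤* (0≤fromℕ (binomPrefix n n)) (0≤1/ℕ (suc n))) ⟩
  R                                   ≡⟨ sumFrom1-cong absorb n ⟩
  sumFrom1 n (λ k → recip (suc n) * fromℕ (suc n C k))   ≡⟨ sumFrom1-* (recip (suc n)) _ n ⟩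
  recip (suc n) * sumFrom1 n (λ k → fromℕ (suc n C k))   ≤⟨ *-monoˡ-≤-0≤ (0≤1/ℕ (suc n)) (sumFrom1-C≤2^ n) ⟩
  recip (suc n) * fromℕ (2 ^ suc n)   ∎
  where
  open ℚP.≤-Reasoning
  b = λ k → fromℕ (binomPrefix n k)
  Σ = sumFrom1 n (λ k → b k * (recip k - recip (suc k)))
  X = b n * recip (suc n)
  R = sumFrom1 n (λ k → (b k - b (ℕ.pred k)) * recip k)
  absorb : ∀ j → (b (suc j) - b j) * recip (suc j) ≡ recip (suc n) * fromℕ (suc n C suc j)
  absorb j = begin-equality
    (fromℕ (binomPrefix n j ℕ.+ n C j) - b j) * 1/ℕ (suc j)   ≡⟨ cong (λ z → (z - b j) * 1/ℕ (suc j)) (fromℕ-+ (binomPrefix n j) (n C j)) ⟩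
    (b j + fromℕ (n C j) - b j) * 1/ℕ (suc j)                 ≡⟨ cancel (b j) (fromℕ (n C j)) (1/ℕ (suc j)) ⟩
    fromℕ (n C j) * 1/ℕ (suc j)                               ≡⟨ nCk/[1+k]≡[1+n]C[1+k]/[1+n] n j ⟩
    fromℕ (suc n C suc j) * 1/ℕ (suc n)                       ≡⟨ ℚP.*-comm (fromℕ (suc n C suc j)) (1/ℕ (suc n)) ⟩
    1/ℕ (suc n) * fromℕ (suc n C suc j)                       ∎
    where
    cancel : ∀ x y z → (x + y - x) * z ≡ y * z
    cancel = solve-∀ ℚ-ring

∣etaTerm∣≡invPow : ∀ s j → ∣ etaTerm s (suc j) ∣ ≡ invPow j s
∣etaTerm∣≡invPow s j = begin
  ∣ sign j * invPow j s ∣          ≡⟨ ℚP.∣p*q∣≡∣p∣*∣q∣ (sign j) (invPow j s) ⟩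
  ∣ sign j ∣ * ∣ invPow j s ∣      ≡⟨ cong₂ _*_ (∣sign∣≡1 j) (ℚP.0≤p⇒∣p∣≡p (0≤invPow j s)) ⟩
  1ℚ * invPow j s                  ≡⟨ ℚP.*-identityˡ (invPow j s) ⟩
  invPow j s                       ∎
  where open ≡-Reasoning

∣defect∣≤ : ∀ {s} → 2 ℕ.≤ s → ∀ n → ∣ defect s n ∣ ≤ fromℕ 4 * recip (suc n)
∣defect∣≤ {s} 2≤s n = begin
  ∣ ½^ n * Σ ∣                                      ≡⟨ ℚP.∣p*q∣≡∣p∣*∣q∣ (½^ n) Σ ⟩
  ∣ ½^ n ∣ * ∣ Σ ∣                                  ≡⟨ cong (_* ∣ Σ ∣) (ℚP.0≤p⇒∣p∣≡p 0≤½^n) ⟩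
  ½^ n * ∣ Σ ∣                                      ≤⟨ *-monoˡ-≤-0≤ 0≤½^n (∣sumFrom1∣≤sumFrom1∣∣ _ n) ⟩
  ½^ n * sumFrom1 n (λ k → ∣ e k * b k ∣)           ≤⟨ *-monoˡ-≤-0≤ 0≤½^n (sumFrom1-mono-≤ ∣term∣≤ n) ⟩
  ½^ n * sumFrom1 n (λ k → fromℕ 2 * G k)           ≡⟨ cong (½^ n *_) (sumFrom1-* (fromℕ 2) G n) ⟩
  ½^ n * (fromℕ 2 * sumFrom1 n G)                   ≤⟨ *-monoˡ-≤-0≤ 0≤½^n (*-monoˡ-≤-0≤ (0≤fromℕ 2) (binomPrefix-weighted-≤ n)) ⟩
  ½^ n * (fromℕ 2 * (recip (suc n) * fromℕ (2 ^ suc n)))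
    ≡⟨ cong (λ z → ½^ n * (fromℕ 2 * (recip (suc n) * z))) (fromℕ-* 2 (2 ^ n)) ⟩
  ½^ n * (fromℕ 2 * (recip (suc n) * (fromℕ 2 * fromℕ (2 ^ n))))
    ≡⟨ regroup (½^ n) (recip (suc n)) (fromℕ (2 ^ n)) ⟩
  fromℕ 4 * recip (suc n) * (½^ n * fromℕ (2 ^ n))  ≡⟨ cong (fromℕ 4 * recip (suc n) *_) (½^-inverse n) ⟩
  fromℕ 4 * recip (suc n) * 1ℚ                      ≡⟨ ℚP.*-identityʳ _ ⟩
  fromℕ 4 * recip (suc n)                           ∎
  where
  open ℚP.≤-Reasoning
  e = etaTerm s
  b = λ k → fromℕ (binomPrefix n k)
  Σ = sumFrom1 n (λ k → e k * b k)
  G = λ k → b k * (recip k - recip (suc k))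
  0≤½^n : 0ℚ ≤ ½^ n
  0≤½^n = 0≤1/ℕ (2 ^ n) {{ℕP.m^n≢0 2 n}}
  ∣term∣≤ : ∀ j → ∣ e (suc j) * b (suc j) ∣ ≤ fromℕ 2 * G (suc j)
  ∣term∣≤ j = begin
    ∣ e (suc j) * b (suc j) ∣                        ≡⟨ ℚP.∣p*q∣≡∣p∣*∣q∣ (e (suc j)) (b (suc j)) ⟩
    ∣ e (suc j) ∣ * ∣ b (suc j) ∣                    ≡⟨ cong₂ _*_ (∣etaTerm∣≡invPow s j) (ℚP.0≤p⇒∣p∣≡p (0≤fromℕ (binomPrefix n (suc j)))) ⟩
    invPow j s * b (suc j)                           ≤⟨ *-monoʳ-≤-0≤ (0≤fromℕ (binomPrefix n (suc j))) (invPow-≤-telescope 2≤s j) ⟩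
    fromℕ 2 * (recip (suc j) - recip (suc (suc j))) * b (suc j)   ≡⟨ comm (fromℕ 2) (recip (suc j) - recip (suc (suc j))) (b (suc j)) ⟩
    fromℕ 2 * G (suc j)                              ∎
    where
    comm : ∀ t d x → t * d * x ≡ t * (x * d)
    comm = solve-∀ ℚ-ring
  regroup : ∀ h r p → h * (fromℕ 2 * (r * (fromℕ 2 * p))) ≡ fromℕ 4 * r * (h * p)
  regroup = solve-∀ ℚ-ring

module _ (m : ℕ) where

  private
    c : ℚ
    c = fromℕ (2 ^ m)
    ζ η : ℕ → ℚ
    ζ = zetaPartial (suc m)
    η = etaPartial (suc m)
    w : ℕ → ℚ
    w j = invPow j (suc m)

  eta-zeta-even : ∀ h → c * η (double h) ≡ c * ζ (double h) - ζ h
  eta-zeta-odd  : ∀ h → c * η (suc (double h)) ≡ c * ζ (suc (double h)) - ζ h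

  eta-zeta-even zero    = x*0≡x*0-0 c
    where
    x*0≡x*0-0 : ∀ x → x * 0ℚ ≡ x * 0ℚ - 0ℚ
    x*0≡x*0-0 = solve-∀ ℚ-ring
  eta-zeta-even (suc h) = begin
    c * (η (suc D) + - sign D * w (suc D))   ≡⟨ cong (λ σ → c * (η (suc D) + - σ * w (suc D))) (sign-double h) ⟩
    c * (η (suc D) + - 1ℚ * w (suc D))       ≡⟨ expand c (η (suc D)) (w (suc D)) ⟩
    c * η (suc D) - c * w (suc D)            ≡⟨ cong (_- c * w (suc D)) (eta-zeta-odd h) ⟩
    (c * ζ (suc D) - ζ h) - c * w (suc D)    ≡⟨ regroup c (ζ (suc D)) (ζ h) (w (suc D)) ⟩
    c * (ζ (suc D) + w (suc D)) - (ζ h + (fromℕ 2 * c) * w (suc D))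
      ≡⟨ cong (λ t → c * ζ (suc (suc D)) - (ζ h + t * w (suc D))) (fromℕ-* 2 (2 ^ m)) ⟨
    c * ζ (suc (suc D)) - (ζ h + fromℕ (2 ^ suc m) * w (suc D))
      ≡⟨ cong (λ t → c * ζ (suc (suc D)) - (ζ h + t)) (invPow-scale 2 (suc D) h (suc m) 2+2h≡2[1+h]) ⟩
    c * ζ (suc (suc D)) - ζ (suc h)          ∎
    where
    open ≡-Reasoning
    D = double h
    expand : ∀ c x y → c * (x + - 1ℚ * y) ≡ c * x - c * y
    expand = solve-∀ ℚ-ring
    regroup : ∀ c z z′ y → (c * z - z′) - c * y ≡ c * (z + y) - (z′ + (fromℕ 2 * c) * y)
    regroup = solve-∀ ℚ-ring
    2+2h≡2[1+h] : suc (suc D) ≡ 2 ℕ.* suc h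
    2+2h≡2[1+h] = trans (cong (λ k → suc (suc k)) (double≡n+n h)) (2+x+x≡2[1+x] h)
      where
      2+x+x≡2[1+x] : ∀ x → suc (suc (x ℕ.+ x)) ≡ 2 ℕ.* suc x
      2+x+x≡2[1+x] = solve-∀ ℕ-Ring.ring
  eta-zeta-odd h = begin
    c * (η D + sign D * w D)        ≡⟨ cong (λ σ → c * (η D + σ * w D)) (sign-double h) ⟩
    c * (η D + 1ℚ * w D)            ≡⟨ expand c (η D) (w D) ⟩
    c * η D + c * w D               ≡⟨ cong (_+ c * w D) (eta-zeta-even h) ⟩
    (c * ζ D - ζ h) + c * w D       ≡⟨ regroup c (ζ D) (ζ h) (w D) ⟩
    c * (ζ D + w D) - ζ h           ∎
    where
    open ≡-Reasoning
    D = double h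
    expand : ∀ c x y → c * (x + 1ℚ * y) ≡ c * x + c * y
    expand = solve-∀ ℚ-ring
    regroup : ∀ c z z′ y → (c * z - z′) + c * y ≡ c * (z + y) - z′
    regroup = solve-∀ ℚ-ring

  twoPowMinus1*ζ-twoPow*η≡ζ-ζ : ∀ h n → c * η n ≡ c * ζ n - ζ h →
                                twoPowMinus1 m * ζ n - twoPow m * η n ≡ ζ h - ζ n
  twoPowMinus1*ζ-twoPow*η≡ζ-ζ h n cη≡cζ-ζh = begin
    fromℕ (2 ^ m ℕ.∸ 1) * ζ n - c * η n   ≡⟨ cong₂ (λ a e → a * ζ n - e) (fromℕ-∸ (2 ^ m) 1 (ℕP.m^n>0 2 m)) cη≡cζ-ζh ⟩
    (c - 1ℚ) * ζ n - (c * ζ n - ζ h)      ≡⟨ cancel c (ζ n) (ζ h) ⟩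
    ζ h - ζ n                              ∎
    where
    open ≡-Reasoning
    cancel : ∀ c z z′ → (c - 1ℚ) * z - (c * z - z′) ≡ z′ - z
    cancel = solve-∀ ℚ-ring

  eta-zeta-gap : 1 ℕ.≤ m → ∀ n → ∣ twoPowMinus1 m * ζ n - twoPow m * η n ∣ ≤ fromℕ 4 * recip (suc n)
  eta-zeta-gap 1≤m n with parity n
  ... | h , inj₁ refl =
    ℚP.≤-trans (ℚP.≤-reflexive (cong ∣_∣ (twoPowMinus1*ζ-twoPow*η≡ζ-ζ h (double h) (eta-zeta-even h))))
               (zeta-gap (ℕ.s≤s 1≤m) h h (sym (double≡n+n h)) (ℕP.n≤1+n h))
  ... | h , inj₂ refl =
    ℚP.≤-trans (ℚP.≤-reflexive (cong ∣_∣ (twoPowMinus1*ζ-twoPow*η≡ζ-ζ h (suc (double h)) (eta-zeta-odd h))))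
               (zeta-gap (ℕ.s≤s 1≤m) h (suc h) (cong suc (sym (double≡n+n h))) ℕP.≤-refl)

error-bound : ∀ m → 1 ℕ.≤ m → ∀ n →
              ∣ twoPowMinus1 m * zetaPartial (suc m) n - twoPow m * rhsPartial m n ∣
                ≤ fromℕ (4 ℕ.+ 2 ^ m ℕ.* 4) * recip (suc n)
error-bound m 1≤m n = begin
  ∣ a * ζ - c * rhsPartial m n ∣   ≡⟨ cong (λ r → ∣ a * ζ - c * r ∣) (rhsPartial≡etaPartial-defect m n) ⟩
  ∣ a * ζ - c * (η - E) ∣          ≡⟨ cong ∣_∣ (split a ζ c η E) ⟩
  ∣ (a * ζ - c * η) + c * E ∣      ≤⟨ ℚP.∣p+q∣≤∣p∣+∣q∣ (a * ζ - c * η) (c * E) ⟩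
  ∣ a * ζ - c * η ∣ + ∣ c * E ∣    ≡⟨ cong (λ x → ∣ a * ζ - c * η ∣ + x) ∣c*E∣≡c*∣E∣ ⟩
  ∣ a * ζ - c * η ∣ + c * ∣ E ∣    ≤⟨ ℚP.+-mono-≤ (eta-zeta-gap m 1≤m n)
                                                   (*-monoˡ-≤-0≤ (0≤fromℕ (2 ^ m)) (∣defect∣≤ (ℕ.s≤s 1≤m) n)) ⟩
  fromℕ 4 * r + c * (fromℕ 4 * r)  ≡⟨ factor (fromℕ 4) r c ⟩
  (fromℕ 4 + c * fromℕ 4) * r      ≡⟨ cong (_* r) (trans (fromℕ-+ 4 (2 ^ m ℕ.* 4))
                                                         (cong (λ x → fromℕ 4 + x) (fromℕ-* (2 ^ m) 4))) ⟨
  fromℕ (4 ℕ.+ 2 ^ m ℕ.* 4) * r    ∎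
  where
  open ℚP.≤-Reasoning
  a = twoPowMinus1 m
  c = twoPow m
  ζ = zetaPartial (suc m) n
  η = etaPartial (suc m) n
  E = defect (suc m) n
  r = recip (suc n)
  split : ∀ a z c e d → a * z - c * (e - d) ≡ (a * z - c * e) + c * d
  split = solve-∀ ℚ-ring
  factor : ∀ f r c → f * r + c * (f * r) ≡ (f + c * f) * r
  factor = solve-∀ ℚ-ring
  ∣c*E∣≡c*∣E∣ : ∣ c * E ∣ ≡ c * ∣ E ∣
  ∣c*E∣≡c*∣E∣ = trans (ℚP.∣p*q∣≡∣p∣*∣q∣ c E) (cong (_* ∣ E ∣) (ℚP.0≤p⇒∣p∣≡p (0≤fromℕ (2 ^ m))))

eventually-< : ∀ K ε → 0ℚ < ε → ∃ λ N₀ → ∀ n → n ≥ N₀ → fromℕ K * recip (suc n) < ε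
eventually-< K (ℚ.mkℚ (+ zero)     _ _) 0<ε = ⊥-elim (ℤ.Positive.pos (ℚ.positive 0<ε))
eventually-< K (ℚ.mkℚ ℤ.-[1+ _ ]   _ _) 0<ε = ⊥-elim (ℤ.Positive.pos (ℚ.positive 0<ε))
eventually-< K ε@(ℚ.mkℚ (+ suc p) q-1 _) 0<ε = K ℕ.* suc q-1 , below
  where
  below : ∀ n → n ≥ K ℕ.* suc q-1 → fromℕ K * recip (suc n) < ε
  below n n≥Kq = begin-strict
    fromℕ K * 1/ℕ (suc n)              <⟨ cross-< K (suc p) (suc n) (suc q-1) Kq<[1+p][1+n] ⟩
    fromℕ (suc p) * 1/ℕ (suc q-1)      ≡⟨ /≡fromℕ*1/ℕ (suc p) (suc q-1) ⟨
    + suc p / suc q-1                  ≡⟨ ℚP.↥p/↧p≡p ε ⟩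
    ε                                  ∎
    where
    open ℚP.≤-Reasoning
    Kq<[1+p][1+n] : K ℕ.* suc q-1 ℕ.< suc p ℕ.* suc n
    Kq<[1+p][1+n] = ℕP.<-≤-trans (ℕ.s≤s n≥Kq) (ℕP.m≤n*m (suc n) (suc p))

mainTheorem10 : (m : ℕ) → m ≥ 1 →
    (ε : ℚ) → 0ℚ < ε →
    ∃ λ N₀ → (N : ℕ) → N ≥ N₀ →
    ∣ twoPowMinus1 m * zetaPartial (suc m) N - twoPow m * rhsPartial m N ∣ < ε
mainTheorem10 m m≥1 ε 0<ε with eventually-< (4 ℕ.+ 2 ^ m ℕ.* 4) ε 0<ε
... | N₀ , below = N₀ , λ N N≥N₀ → ℚP.≤-<-trans (error-bound m m≥1 N) (below N N≥N₀)
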